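{- Fix an integer $k\geq 1$ and let $\mathbb{F}=\mathbb{C}(x_0,\ldots,x_{2k},a)$. Let $\varphi$ be the map $(x_0,\ldots,x_{2k})\mapsto\big(x_1,\ldots,x_{2k},(x_1x_{2k}+a(x_k+x_{k+1}))/x_0\big)$, with pullback $\varphi^*G(x_0,\ldots,x_{2k},a)=G(x_1,\ldots,x_{2k},x_{2k+1},a)$ where $x_{2k+1}=(x_1x_{2k}+a(x_k+x_{k+1}))/x_0$. Let $K=P^{(0)}+aP^{(1)}+a^2P^{(2)}\in\mathbb{F}$ with $$P^{(0)}=1+\frac{x_0}{x_{2k}}+\frac{x_{2k}}{x_0},$$ $$P^{(1)}=\Big(1+\frac{x_{2k}}{x_0}\Big)\sum_{j=1}^k\frac{x_{j-1}+x_j}{x_{j+k-1}x_{j+k}}+\Big(1+\frac{x_0}{x_{2k}}\Big)\sum_{j=1}^k\frac{x_{j+k-1}+x_{j+k}}{x_{j-1}x_j},$$ $$P^{(2)}=\frac{1}{x_kx_{2k}}+\sum_{j=0}^{k-1}\frac{1}{x_j}\Big(\frac{1}{x_{j+k}}+\frac{1}{x_{j+k+1}}\Big)+\sum_{\ell=1}^{k-1}\sum_{m=1}^{\ell}\frac{(x_\ell+x_{\ell+1})(x_{k+m-1}+x_{k+m})}{x_{k+\ell}x_{k+\ell+1}x_{m-1}x_m}.$$ Then $\varphi^*K=K$, i.e. $K$ is a first integral (conserved quantity) of $\varphi$. -}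

module Defs where

open import Level using (Level; _⊔_) renaming (suc to lsuc)
open import Data.Nat using (ℕ; zero; suc; _≟_) renaming (_+_ to _+ℕ_; _∸_ to _∸ℕ_)
open import Relation.Nullary using (¬_; yes; no)
open import Algebra.Bundles using (CommutativeRing)

-- The inverse is given as a total
-- (setoid-respecting) operation; its value at 0 is irrelevant and never
-- used below except where the hypotheses force the argument to be nonzero.
record Field (c ℓ : Level) : Set (lsuc (c ⊔ ℓ)) where
  field
    commutativeRing : CommutativeRing c ℓ
  open CommutativeRing commutativeRing public
  field
    _⁻¹      : Carrier → Carrier
    ⁻¹-cong  : ∀ {x y} → x ≈ y → x ⁻¹ ≈ y ⁻¹
    ⁻¹-inverse : ∀ x → ¬ (x ≈ 0#) → x * x ⁻¹ ≈ 1#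
    1≉0      : ¬ (1# ≈ 0#)

  infixl 7 _/_
  _/_ : Carrier → Carrier → Carrier
  x / y = x * y ⁻¹

  fromℕ : ℕ → Carrier
  fromℕ zero    = 0#
  fromℕ (suc n) = 1# + fromℕ n

  CharZero : Set ℓ
  CharZero = ∀ n → ¬ (fromℕ (suc n) ≈ 0#)

  ΣR : ℕ → (ℕ → Carrier) → Carrier
  ΣR zero    f = 0#
  ΣR (suc n) f = ΣR n f + f n

  Σ1 : ℕ → (ℕ → Carrier) → Carrier
  Σ1 n f = ΣR n (λ i → f (suc i))


module FirstIntegral {c ℓ : Level} (F : Field c ℓ) where
  open Field F

  -- Points (x_0,...,x_{2k}) are represented as x : ℕ → Carrier; only the
  -- entries x 0 , ... , x (2k) are read by the definitions below.
  module _ (k : ℕ) (a : Carrier) (x : ℕ → Carrier) where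
    private
      n = k +ℕ k

    P0 : Carrier
    P0 = 1# + x 0 / x n + x n / x 0

    P1 : Carrier
    P1 = (1# + x n / x 0) * Σ1 k (λ j → (x (j ∸ℕ 1) + x j) / (x (j +ℕ k ∸ℕ 1) * x (j +ℕ k)))
       + (1# + x 0 / x n) * Σ1 k (λ j → (x (j +ℕ k ∸ℕ 1) + x (j +ℕ k)) / (x (j ∸ℕ 1) * x j))

    P2 : Carrier
    P2 = 1# / (x k * x n)
       + ΣR k (λ j → (1# / x j) * (1# / x (j +ℕ k) + 1# / x (j +ℕ k +ℕ 1)))
       + Σ1 (k ∸ℕ 1) (λ l → Σ1 l (λ m →
           ((x l + x (l +ℕ 1)) * (x (k +ℕ m ∸ℕ 1) + x (k +ℕ m)))
           / (x (k +ℕ l) * x (k +ℕ l +ℕ 1) * x (m ∸ℕ 1) * x m)))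

    K : Carrier
    K = P0 + a * P1 + (a * a) * P2

    next : Carrier
    next = (x 1 * x n + a * (x k + x (k +ℕ 1))) / x 0

    φ : ℕ → Carrier
    φ i with i ≟ n
    ... | yes _ = next
    ... | no  _ = x (suc i)

  φ*K : ℕ → Carrier → (ℕ → Carrier) → Carrier
  φ*K k a x = K k a (φ k a x)

module Submission where

-- Extend x by x₂ₖ₊₁ (and by 1 further on) to a nowhere-vanishing sequence w. Since K only reads the
-- entries 0 … 2k, φ*K x = K (w ∘ suc) and K x = K w, so it suffices that K is invariant under the shift of
-- any such w satisfying the recurrence w₀ w₂ₖ₊₁ = w₁ w₂ₖ + a (wₖ + wₖ₊₁).
-- Let A, B, E be the sums of P⁽¹⁾ and P⁽²⁾, with summands Tⱼ, Sⱼ, Eⱼ. Under the shift they telescope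
-- (A′ = A + Tₖ − T₀, …), and the double sum D = Σ_{m ≤ l} Tₗ Sₘ₋₁ becomes D + Tₖ B − S₀ A′. The
-- recurrence gives w₂ₖ₊₁/w₁ = w₂ₖ/w₀ + a S₀ and w₀/w₂ₖ = w₁/w₂ₖ₊₁ + a Tₖ, which cancel every term
-- containing A or B; what remains is a rational identity in w₀, w₁, wₖ, wₖ₊₁, w₂ₖ, w₂ₖ₊₁.

open import Defs
open import Level using (Level)
open import Data.Nat.Base using (ℕ; zero; suc; _≤_; _<_; z≤n; s≤s; _∸_) renaming (_+_ to _+ℕ_)
open import Data.Nat.Properties
  using (_≤?_; _≟_; ≤-refl; ≤-trans; <⇒≤; ≤∧≢⇒<; 1+n≰n; m≤m+n; m≤n+m; +-monoˡ-≤; m<n⇒m<1+n; +-suc)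
  renaming (+-comm to +ℕ-comm)
open import Relation.Nullary using (¬_; yes; no; contradiction)
import Relation.Binary.PropositionalEquality as ≡
open ≡ using (_≡_)
import Algebra.Solver.Ring.NaturalCoefficients.Default as NatSolver

module FieldProperties {c ℓ : Level} (F : Field c ℓ) where
  open Field F
  open NatSolver commutativeSemiring using (solve; _:=_; _:+_; _:*_; con)
  open import Algebra.Properties.Group +-group using (∙-cancelʳ)
  open import Relation.Binary.Reasoning.Setoid setoid

  x*y≉0 : ∀ {x y} → x ≉ 0# → y ≉ 0# → x * y ≉ 0#
  x*y≉0 {x} {y} x≉0 y≉0 xy≈0 = x≉0 (begin
    x                ≈⟨ *-identityʳ x ⟨
    x * 1#           ≈⟨ *-congˡ (⁻¹-inverse y y≉0) ⟨
    x * (y * y ⁻¹)   ≈⟨ *-assoc x y (y ⁻¹) ⟨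
    x * y * y ⁻¹     ≈⟨ *-congʳ xy≈0 ⟩
    0# * y ⁻¹        ≈⟨ zeroˡ (y ⁻¹) ⟩
    0#               ∎)

  ⁻¹-unique : ∀ {x y} → x ≉ 0# → x * y ≈ 1# → x ⁻¹ ≈ y
  ⁻¹-unique {x} {y} x≉0 xy≈1 = begin
    x ⁻¹              ≈⟨ *-identityʳ (x ⁻¹) ⟨
    x ⁻¹ * 1#         ≈⟨ *-congˡ xy≈1 ⟨
    x ⁻¹ * (x * y)    ≈⟨ solve 3 (λ u x y → u :* (x :* y) := (x :* u) :* y) refl (x ⁻¹) x y ⟩
    x * x ⁻¹ * y      ≈⟨ *-congʳ (⁻¹-inverse x x≉0) ⟩
    1# * y            ≈⟨ *-identityˡ y ⟩
    y                 ∎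

  ⁻¹-distrib-* : ∀ {x y} → x ≉ 0# → y ≉ 0# → (x * y) ⁻¹ ≈ x ⁻¹ * y ⁻¹
  ⁻¹-distrib-* {x} {y} x≉0 y≉0 = ⁻¹-unique (x*y≉0 x≉0 y≉0) (begin
    x * y * (x ⁻¹ * y ⁻¹)      ≈⟨ solve 4 (λ x y u v → x :* y :* (u :* v) := x :* u :* (y :* v))
                                           refl x y (x ⁻¹) (y ⁻¹) ⟩
    x * x ⁻¹ * (y * y ⁻¹)      ≈⟨ *-cong (⁻¹-inverse x x≉0) (⁻¹-inverse y y≉0) ⟩
    1# * 1#                    ≈⟨ *-identityˡ 1# ⟩
    1#                         ∎)

  x*x⁻¹*y≈y : ∀ {x} y → x ≉ 0# → x * x ⁻¹ * y ≈ y
  x*x⁻¹*y≈y {x} y x≉0 = trans (*-congʳ (⁻¹-inverse x x≉0)) (*-identityˡ y)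

  /-cong : ∀ {x x′ y y′} → x ≈ x′ → y ≈ y′ → x / y ≈ x′ / y′
  /-cong x≈x′ y≈y′ = *-cong x≈x′ (⁻¹-cong y≈y′)

  x*[y/x]≈y : ∀ {x} y → x ≉ 0# → x * (y / x) ≈ y
  x*[y/x]≈y {x} y x≉0 =
    trans (solve 3 (λ x y u → x :* (y :* u) := x :* u :* y) refl x y (x ⁻¹)) (x*x⁻¹*y≈y y x≉0)

  /-*-distrib : ∀ {P Q x y z t} → x ≉ 0# → y ≉ 0# → z ≉ 0# → t ≉ 0# →
                P * Q / (x * y * z * t) ≈ P / (x * y) * (Q / (z * t))
  /-*-distrib {P} {Q} {x} {y} {z} {t} x≉0 y≉0 z≉0 t≉0 = begin
    P * Q * (x * y * z * t) ⁻¹          ≈⟨ *-congˡ (⁻¹-cong (*-assoc (x * y) z t)) ⟩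
    P * Q * (x * y * (z * t)) ⁻¹        ≈⟨ *-congˡ (⁻¹-distrib-* (x*y≉0 x≉0 y≉0) (x*y≉0 z≉0 t≉0)) ⟩
    P * Q * ((x * y) ⁻¹ * (z * t) ⁻¹)   ≈⟨ solve 4 (λ P Q u w → P :* Q :* (u :* w) := P :* u :* (Q :* w))
                                                refl P Q ((x * y) ⁻¹) ((z * t) ⁻¹) ⟩
    P * (x * y) ⁻¹ * (Q * (z * t) ⁻¹)   ∎

  ratio-step : ∀ {a p q x y s} → p ≉ 0# → q ≉ 0# → p * y ≈ q * x + a * s →
               y / q ≈ x / p + a * (s / (p * q))
  ratio-step {a} {p} {q} {x} {y} {s} p≉0 q≉0 py≈qx+as = begin
    y * q ⁻¹
      ≈⟨ x*x⁻¹*y≈y (y * q ⁻¹) p≉0 ⟨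
    p * p ⁻¹ * (y * q ⁻¹)
      ≈⟨ solve 4 (λ p u y v → p :* u :* (y :* v) := p :* y :* (u :* v)) refl p (p ⁻¹) y (q ⁻¹) ⟩
    p * y * (p ⁻¹ * q ⁻¹)
      ≈⟨ *-congʳ py≈qx+as ⟩
    (q * x + a * s) * (p ⁻¹ * q ⁻¹)
      ≈⟨ solve 6 (λ q x a s u v →
           (q :* x :+ a :* s) :* (u :* v) := q :* v :* (x :* u) :+ a :* (s :* (u :* v)))
           refl q x a s (p ⁻¹) (q ⁻¹) ⟩
    q * q ⁻¹ * (x * p ⁻¹) + a * (s * (p ⁻¹ * q ⁻¹))
      ≈⟨ +-cong (x*x⁻¹*y≈y (x * p ⁻¹) q≉0) (*-congˡ (*-congˡ (sym (⁻¹-distrib-* p≉0 q≉0)))) ⟩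
    x * p ⁻¹ + a * (s * (p * q) ⁻¹)
      ∎

  ratio-cross : ∀ {s x x′ y z} → x ≉ 0# → x′ ≉ 0# → y ≉ 0# → z ≉ 0# →
                x / y * (s / (x * z)) ≈ x′ / z * (s / (y * x′))
  ratio-cross {s} {x} {x′} {y} {z} x≉0 x′≉0 y≉0 z≉0 = begin
    x / y * (s / (x * z))      ≈⟨ cancel x≉0 z≉0 ⟩
    s * (y ⁻¹ * z ⁻¹)          ≈⟨ *-congˡ (*-comm (y ⁻¹) (z ⁻¹)) ⟩
    s * (z ⁻¹ * y ⁻¹)          ≈⟨ cancel x′≉0 y≉0 ⟨
    x′ / z * (s / (x′ * y))    ≈⟨ *-congˡ (*-congˡ (⁻¹-cong (*-comm x′ y))) ⟩
    x′ / z * (s / (y * x′))    ∎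
    where
    cancel : ∀ {x y z} → x ≉ 0# → z ≉ 0# → x / y * (s / (x * z)) ≈ s * (y ⁻¹ * z ⁻¹)
    cancel {x} {y} {z} x≉0 z≉0 = begin
      x * y ⁻¹ * (s * (x * z) ⁻¹)        ≈⟨ *-congˡ (*-congˡ (⁻¹-distrib-* x≉0 z≉0)) ⟩
      x * y ⁻¹ * (s * (x ⁻¹ * z ⁻¹))
        ≈⟨ solve 5 (λ x v s u w → x :* v :* (s :* (u :* w)) := x :* u :* (s :* (v :* w)))
             refl x (y ⁻¹) s (x ⁻¹) (z ⁻¹) ⟩
      x * x ⁻¹ * (s * (y ⁻¹ * z ⁻¹))     ≈⟨ x*x⁻¹*y≈y _ x≉0 ⟩
      s * (y ⁻¹ * z ⁻¹)                  ∎

  residual-half : ∀ {a p q r t x y} → r ≉ 0# → t ≉ 0# → y ≉ 0# → p * y ≈ q * x + a * (r + t) →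
    (1# + q * y ⁻¹) * (x + y) * (r ⁻¹ * t ⁻¹) + a * (r ⁻¹ + t ⁻¹) * y ⁻¹ ≈ (p + q + x + y) * (r ⁻¹ * t ⁻¹)
  residual-half {a} {p} {q} {r} {t} {x} {y} r≉0 t≉0 y≉0 py≈qx+a[r+t] = begin
    (1# + q * u) * (x + y) * (v * w) + a * (v + w) * u
      ≈⟨ solve 7 (λ a q u x y v w →
           (con 1 :+ q :* u) :* (x :+ y) :* (v :* w) :+ a :* (v :+ w) :* u
           := (x :+ y :+ q :* x :* u :+ q :* (y :* u)) :* (v :* w)
                :+ a :* u :* v :* con 1 :+ a :* u :* w :* con 1)
         refl a q u x y v w ⟩
    (x + y + q * x * u + q * (y * u)) * (v * w) + a * u * v * 1# + a * u * w * 1#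
      ≈⟨ +-cong (+-cong (*-congʳ (+-congˡ (*-congˡ yu≈1))) (*-congˡ (sym tw≈1))) (*-congˡ (sym rv≈1)) ⟩
    (x + y + q * x * u + q * 1#) * (v * w) + a * u * v * (t * w) + a * u * w * (r * v)
      ≈⟨ solve 9 (λ a q r t u v w x y →
           (x :+ y :+ q :* x :* u :+ q :* con 1) :* (v :* w)
             :+ a :* u :* v :* (t :* w) :+ a :* u :* w :* (r :* v)
           := (q :* x :+ a :* (r :+ t)) :* u :* (v :* w) :+ (q :+ x :+ y) :* (v :* w))
         refl a q r t u v w x y ⟩
    (q * x + a * (r + t)) * u * (v * w) + (q + x + y) * (v * w)
      ≈⟨ +-congʳ (*-congʳ (*-congʳ py≈qx+a[r+t])) ⟨
    p * y * u * (v * w) + (q + x + y) * (v * w)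
      ≈⟨ +-congʳ (*-congʳ (*-assoc p y u)) ⟩
    p * (y * u) * (v * w) + (q + x + y) * (v * w)
      ≈⟨ +-congʳ (*-congʳ (*-congˡ yu≈1)) ⟩
    p * 1# * (v * w) + (q + x + y) * (v * w)
      ≈⟨ solve 6 (λ p q v w x y →
           p :* con 1 :* (v :* w) :+ (q :+ x :+ y) :* (v :* w) := (p :+ q :+ x :+ y) :* (v :* w))
         refl p q v w x y ⟩
    (p + q + x + y) * (v * w) ∎
    where
    u v w : Carrier
    u = y ⁻¹
    v = r ⁻¹
    w = t ⁻¹
    yu≈1 : y * u ≈ 1#
    yu≈1 = ⁻¹-inverse y y≉0
    rv≈1 : r * v ≈ 1#
    rv≈1 = ⁻¹-inverse r r≉0
    tw≈1 : t * w ≈ 1#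
    tw≈1 = ⁻¹-inverse t t≉0

  -- Both sides equal (w₀ + w₁ + wₙ + wₙ₊₁) / (wₖ wₖ₊₁) + a / (wₖ wₙ): residual-half is applied to the
  -- recurrence and to its mirror image under w₀ ↔ wₙ₊₁, w₁ ↔ wₙ.
  residual-identity : ∀ {a w₀ w₁ wₖ wₖ₊₁ wₙ wₙ₊₁} →
    w₀ ≉ 0# → wₖ ≉ 0# → wₖ₊₁ ≉ 0# → wₙ ≉ 0# → wₙ₊₁ ≉ 0# → w₀ * wₙ₊₁ ≈ w₁ * wₙ + a * (wₖ + wₖ₊₁) →
    (1# + w₁ / wₙ₊₁) * ((wₙ + wₙ₊₁) / (wₖ * wₖ₊₁))
      + a * (1# / (wₖ₊₁ * wₙ₊₁) + 1# / wₖ * (1# / wₙ + 1# / wₙ₊₁))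
    ≈ (1# + wₙ / w₀) * ((w₀ + w₁) / (wₖ * wₖ₊₁))
      + a * (1# / (wₖ * wₙ) + 1# / w₀ * (1# / wₖ + 1# / wₖ₊₁))
  residual-identity {a} {w₀} {w₁} {wₖ} {wₖ₊₁} {wₙ} {wₙ₊₁} w₀≉0 wₖ≉0 wₖ₊₁≉0 wₙ≉0 wₙ₊₁≉0 rec = begin
    (1# + w₁ / wₙ₊₁) * ((wₙ + wₙ₊₁) / (wₖ * wₖ₊₁))
      + a * (1# / (wₖ₊₁ * wₙ₊₁) + 1# / wₖ * (1# / wₙ + 1# / wₙ₊₁))
      ≈⟨ +-cong (*-congˡ (*-congˡ (⁻¹-distrib-* wₖ≉0 wₖ₊₁≉0)))
                (*-congˡ (+-congʳ (*-congˡ (⁻¹-distrib-* wₖ₊₁≉0 wₙ₊₁≉0)))) ⟩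
    (1# + w₁ * u₊) * ((wₙ + wₙ₊₁) * (uₖ * uₖ₊₁)) + a * (1# * (uₖ₊₁ * u₊) + 1# * uₖ * (1# * uₙ + 1# * u₊))
      ≈⟨ solve 8 (λ a w₁ wₙ wₙ₊₁ u₊ uₖ uₖ₊₁ uₙ →
           (con 1 :+ w₁ :* u₊) :* ((wₙ :+ wₙ₊₁) :* (uₖ :* uₖ₊₁))
             :+ a :* (con 1 :* (uₖ₊₁ :* u₊) :+ con 1 :* uₖ :* (con 1 :* uₙ :+ con 1 :* u₊))
           := (con 1 :+ w₁ :* u₊) :* (wₙ :+ wₙ₊₁) :* (uₖ :* uₖ₊₁)
                :+ a :* (uₖ :+ uₖ₊₁) :* u₊ :+ a :* (uₖ :* uₙ))
         refl a w₁ wₙ wₙ₊₁ u₊ uₖ uₖ₊₁ uₙ ⟩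
    (1# + w₁ * u₊) * (wₙ + wₙ₊₁) * (uₖ * uₖ₊₁) + a * (uₖ + uₖ₊₁) * u₊ + a * (uₖ * uₙ)
      ≈⟨ +-congʳ (residual-half wₖ≉0 wₖ₊₁≉0 wₙ₊₁≉0 rec) ⟩
    (w₀ + w₁ + wₙ + wₙ₊₁) * (uₖ * uₖ₊₁) + a * (uₖ * uₙ)
      ≈⟨ +-congʳ (*-congʳ (solve 4 (λ x y z t → x :+ y :+ z :+ t := t :+ z :+ y :+ x) refl w₀ w₁ wₙ wₙ₊₁)) ⟩
    (wₙ₊₁ + wₙ + w₁ + w₀) * (uₖ * uₖ₊₁) + a * (uₖ * uₙ)
      ≈⟨ +-congʳ (residual-half wₖ≉0 wₖ₊₁≉0 w₀≉0 rec′) ⟨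
    (1# + wₙ * u₀) * (w₁ + w₀) * (uₖ * uₖ₊₁) + a * (uₖ + uₖ₊₁) * u₀ + a * (uₖ * uₙ)
      ≈⟨ solve 8 (λ a w₀ w₁ wₙ u₀ uₖ uₖ₊₁ uₙ →
           (con 1 :+ wₙ :* u₀) :* (w₁ :+ w₀) :* (uₖ :* uₖ₊₁) :+ a :* (uₖ :+ uₖ₊₁) :* u₀ :+ a :* (uₖ :* uₙ)
           := (con 1 :+ wₙ :* u₀) :* ((w₀ :+ w₁) :* (uₖ :* uₖ₊₁))
             :+ a :* (con 1 :* (uₖ :* uₙ) :+ con 1 :* u₀ :* (con 1 :* uₖ :+ con 1 :* uₖ₊₁)))
         refl a w₀ w₁ wₙ u₀ uₖ uₖ₊₁ uₙ ⟩
    (1# + wₙ * u₀) * ((w₀ + w₁) * (uₖ * uₖ₊₁)) + a * (1# * (uₖ * uₙ) + 1# * u₀ * (1# * uₖ + 1# * uₖ₊₁))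
      ≈⟨ +-cong (*-congˡ (*-congˡ (⁻¹-distrib-* wₖ≉0 wₖ₊₁≉0)))
                (*-congˡ (+-congʳ (*-congˡ (⁻¹-distrib-* wₖ≉0 wₙ≉0)))) ⟨
    (1# + wₙ / w₀) * ((w₀ + w₁) / (wₖ * wₖ₊₁))
      + a * (1# / (wₖ * wₙ) + 1# / w₀ * (1# / wₖ + 1# / wₖ₊₁))
      ∎
    where
    u₀ uₖ uₖ₊₁ uₙ u₊ : Carrier
    u₀ = w₀ ⁻¹
    uₖ = wₖ ⁻¹
    uₖ₊₁ = wₖ₊₁ ⁻¹
    uₙ = wₙ ⁻¹
    u₊ = wₙ₊₁ ⁻¹
    rec′ : wₙ₊₁ * w₀ ≈ wₙ * w₁ + a * (wₖ + wₖ₊₁)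
    rec′ = trans (*-comm wₙ₊₁ w₀) (trans rec (+-congʳ (*-comm w₁ wₙ)))

  -- Adding C to both sides lets every hypothesis enter as a summand, so what remains is semiring
  -- normalisation.
  K-expression-≈ : ∀ {a ρ ρ₀ σ σ₀ A A′ B B′ E E′ D D′ X X′ T₀ Tₖ S₀ Sₖ E₀ Eₖ} →
    A′ + T₀ ≈ A + Tₖ → B′ + S₀ ≈ B + Sₖ → E′ + E₀ ≈ E + Eₖ → D′ + S₀ * A′ ≈ D + Tₖ * B →
    ρ ≈ ρ₀ + a * S₀ → σ₀ ≈ σ + a * Tₖ → ρ₀ * Tₖ ≈ σ * S₀ →
    (1# + σ) * Sₖ + a * (X′ + Eₖ) ≈ (1# + ρ₀) * T₀ + a * (X + E₀) →
    1# + σ + ρ + a * ((1# + ρ) * A′ + (1# + σ) * B′) + a * a * (X′ + E′ + D′)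
      ≈ 1# + σ₀ + ρ₀ + a * ((1# + ρ₀) * A + (1# + σ₀) * B) + a * a * (X + E + D)
  K-expression-≈ {a} {ρ} {ρ₀} {σ} {σ₀} {A} {A′} {B} {B′} {E} {E′} {D} {D′} {X} {X′}
                 {T₀} {Tₖ} {S₀} {Sₖ} {E₀} {Eₖ} tA tB tE tD ρ≈ σ₀≈ cross residual = ∙-cancelʳ C _ _ (begin
      1# + σ + ρ + a * ((1# + ρ) * A′ + (1# + σ) * B′) + a * a * (X′ + E′ + D′) + C
        ≈⟨ +-congʳ (+-congʳ (+-cong (+-congˡ ρ≈) (*-congˡ (+-congʳ (*-congʳ (+-congˡ ρ≈)))))) ⟩
      1# + σ + ρ′ + a * ((1# + ρ′) * A′ + (1# + σ) * B′) + a * a * (X′ + E′ + D′) + C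
        ≈⟨ regroupˡ ⟩
      Φ (A′ + T₀) (B′ + S₀) (E′ + E₀) (D′ + S₀ * A′) ((1# + σ) * Sₖ + a * (X′ + Eₖ)) (ρ₀ * Tₖ)
        ≈⟨ +-cong (+-cong (+-cong (+-cong (+-cong (+-congˡ (*-congˡ tA)) (*-congˡ tB)) (*-congˡ tE))
                    (*-congˡ tD)) (*-congˡ residual)) (*-congˡ cross) ⟩
      Φ (A + Tₖ) (B + Sₖ) (E + Eₖ) (D + Tₖ * B) ((1# + ρ₀) * T₀ + a * (X + E₀)) (σ * S₀)
        ≈⟨ regroupʳ ⟩
      1# + σ′ + ρ₀ + a * ((1# + ρ₀) * A + (1# + σ′) * B) + a * a * (X + E + D) + C
        ≈⟨ +-congʳ (+-congʳ (+-cong (+-congʳ (+-congˡ σ₀≈)) (*-congˡ (+-congˡ (*-congʳ (+-congˡ σ₀≈)))))) ⟨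
      1# + σ₀ + ρ₀ + a * ((1# + ρ₀) * A + (1# + σ₀) * B) + a * a * (X + E + D) + C ∎)
    where
    ρ′ σ′ C : Carrier
    ρ′ = ρ₀ + a * S₀
    σ′ = σ + a * Tₖ
    C = a * (1# + ρ₀) * T₀ + a * (1# + σ) * S₀ + a * a * E₀ + a * (1# + σ) * Sₖ + a * a * Eₖ + a * ρ₀ * Tₖ
    Φ : Carrier → Carrier → Carrier → Carrier → Carrier → Carrier → Carrier
    Φ α β ε δ μ κ = 1# + σ + ρ₀ + a * S₀ + a * (1# + ρ₀) * α + a * (1# + σ) * β
                  + a * a * ε + a * a * δ + a * μ + a * κ
    regroupˡ : 1# + σ + ρ′ + a * ((1# + ρ′) * A′ + (1# + σ) * B′) + a * a * (X′ + E′ + D′) + C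
               ≈ Φ (A′ + T₀) (B′ + S₀) (E′ + E₀) (D′ + S₀ * A′) ((1# + σ) * Sₖ + a * (X′ + Eₖ)) (ρ₀ * Tₖ)
    regroupˡ = solve 14 (λ a ρ₀ σ A′ B′ X′ E′ D′ T₀ S₀ Sₖ E₀ Eₖ Tₖ →
        con 1 :+ σ :+ (ρ₀ :+ a :* S₀) :+ a :* ((con 1 :+ (ρ₀ :+ a :* S₀)) :* A′ :+ (con 1 :+ σ) :* B′)
          :+ a :* a :* (X′ :+ E′ :+ D′)
          :+ (a :* (con 1 :+ ρ₀) :* T₀ :+ a :* (con 1 :+ σ) :* S₀ :+ a :* a :* E₀ :+ a :* (con 1 :+ σ) :* Sₖ
              :+ a :* a :* Eₖ :+ a :* ρ₀ :* Tₖ)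
      := con 1 :+ σ :+ ρ₀ :+ a :* S₀ :+ a :* (con 1 :+ ρ₀) :* (A′ :+ T₀) :+ a :* (con 1 :+ σ) :* (B′ :+ S₀)
          :+ a :* a :* (E′ :+ E₀) :+ a :* a :* (D′ :+ S₀ :* A′)
          :+ a :* ((con 1 :+ σ) :* Sₖ :+ a :* (X′ :+ Eₖ)) :+ a :* (ρ₀ :* Tₖ))
      refl a ρ₀ σ A′ B′ X′ E′ D′ T₀ S₀ Sₖ E₀ Eₖ Tₖ
    regroupʳ : Φ (A + Tₖ) (B + Sₖ) (E + Eₖ) (D + Tₖ * B) ((1# + ρ₀) * T₀ + a * (X + E₀)) (σ * S₀)
               ≈ 1# + σ′ + ρ₀ + a * ((1# + ρ₀) * A + (1# + σ′) * B) + a * a * (X + E + D) + C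
    regroupʳ = solve 14 (λ a ρ₀ σ A B X E D T₀ S₀ Sₖ E₀ Eₖ Tₖ →
        con 1 :+ σ :+ ρ₀ :+ a :* S₀ :+ a :* (con 1 :+ ρ₀) :* (A :+ Tₖ) :+ a :* (con 1 :+ σ) :* (B :+ Sₖ)
          :+ a :* a :* (E :+ Eₖ) :+ a :* a :* (D :+ Tₖ :* B)
          :+ a :* ((con 1 :+ ρ₀) :* T₀ :+ a :* (X :+ E₀)) :+ a :* (σ :* S₀)
      := con 1 :+ (σ :+ a :* Tₖ) :+ ρ₀ :+ a :* ((con 1 :+ ρ₀) :* A :+ (con 1 :+ (σ :+ a :* Tₖ)) :* B)
          :+ a :* a :* (X :+ E :+ D)
          :+ (a :* (con 1 :+ ρ₀) :* T₀ :+ a :* (con 1 :+ σ) :* S₀ :+ a :* a :* E₀ :+ a :* (con 1 :+ σ) :* Sₖ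
              :+ a :* a :* Eₖ :+ a :* ρ₀ :* Tₖ))
      refl a ρ₀ σ A B X E D T₀ S₀ Sₖ E₀ Eₖ Tₖ

module Sums {c ℓ : Level} (F : Field c ℓ) where
  open Field F
  open NatSolver commutativeSemiring using (solve; _:=_; _:+_; _:*_; con)
  open import Relation.Binary.Reasoning.Setoid setoid

  ΣR-cong : ∀ n {f g : ℕ → Carrier} → (∀ i → f i ≈ g i) → ΣR n f ≈ ΣR n g
  ΣR-cong zero    f≈g = refl
  ΣR-cong (suc n) f≈g = +-cong (ΣR-cong n f≈g) (f≈g n)

  ΣR-cong-< : ∀ n {f g : ℕ → Carrier} → (∀ {i} → i < n → f i ≈ g i) → ΣR n f ≈ ΣR n g
  ΣR-cong-< zero    f≈g = refl
  ΣR-cong-< (suc n) f≈g = +-cong (ΣR-cong-< n (λ i<n → f≈g (m<n⇒m<1+n i<n))) (f≈g ≤-refl)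

  *-distribˡ-ΣR : ∀ n x (f : ℕ → Carrier) → x * ΣR n f ≈ ΣR n (λ i → x * f i)
  *-distribˡ-ΣR zero    x f = zeroʳ x
  *-distribˡ-ΣR (suc n) x f = trans (distribˡ x (ΣR n f) (f n)) (+-congʳ (*-distribˡ-ΣR n x f))

  ΣR-telescope : ∀ n (f : ℕ → Carrier) → ΣR n (λ i → f (suc i)) + f 0 ≈ ΣR n f + f n
  ΣR-telescope zero    f = refl
  ΣR-telescope (suc n) f = begin
    ΣR n (λ i → f (suc i)) + f (suc n) + f 0   ≈⟨ +-assoc _ _ _ ⟩
    ΣR n (λ i → f (suc i)) + (f (suc n) + f 0) ≈⟨ +-congˡ (+-comm (f (suc n)) (f 0)) ⟩
    ΣR n (λ i → f (suc i)) + (f 0 + f (suc n)) ≈⟨ +-assoc _ _ _ ⟨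
    ΣR n (λ i → f (suc i)) + f 0 + f (suc n)   ≈⟨ +-congʳ (ΣR-telescope n f) ⟩
    ΣR n f + f n + f (suc n)                   ∎

  Σtriangle : ℕ → (ℕ → Carrier) → (ℕ → Carrier) → Carrier
  Σtriangle n f g = ΣR n (λ l → f (suc l) * ΣR (suc l) g)

  Σtriangle-shift : ∀ n (f g : ℕ → Carrier) →
    Σtriangle n (λ i → f (suc i)) (λ i → g (suc i)) + g 0 * ΣR (suc n) (λ i → f (suc i))
      ≈ Σtriangle n f g + f (suc n) * ΣR (suc n) g
  Σtriangle-shift zero    f g =
    solve 2 (λ x y → con 0 :+ x :* (con 0 :+ y) := con 0 :+ y :* (con 0 :+ x)) refl (g 0) (f 1)
  Σtriangle-shift (suc n) f g = begin
    Σtriangle n f′ g′ + f (suc (suc n)) * ΣR (suc n) g′ + g 0 * (ΣR (suc n) f′ + f (suc (suc n)))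
      ≈⟨ solve 5 (λ t x s y z → t :+ x :* s :+ y :* (z :+ x) := t :+ y :* z :+ x :* (s :+ y))
           refl (Σtriangle n f′ g′) (f (suc (suc n))) (ΣR (suc n) g′) (g 0) (ΣR (suc n) f′) ⟩
    Σtriangle n f′ g′ + g 0 * ΣR (suc n) f′ + f (suc (suc n)) * (ΣR (suc n) g′ + g 0)
      ≈⟨ +-cong (Σtriangle-shift n f g) (*-congˡ (ΣR-telescope (suc n) g)) ⟩
    Σtriangle n f g + f (suc n) * ΣR (suc n) g + f (suc (suc n)) * (ΣR (suc n) g + g (suc n)) ∎
    where
    f′ g′ : ℕ → Carrier
    f′ i = f (suc i)
    g′ i = g (suc i)

module Summands {c ℓ : Level} (F : Field c ℓ) (k : ℕ) where
  open Field F
  open FirstIntegral F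
  open FieldProperties F
  open Sums F
  open import Relation.Binary.Reasoning.Setoid setoid

  -- The summands of P⁽¹⁾ and P⁽²⁾, indexed from 0, and the double sum of P⁽²⁾ verbatim: K k a v unfolds
  -- definitionally to an expression in ΣR k (T v), ΣR k (S v), ΣR k (E v) and D v.
  T S E : (ℕ → Carrier) → ℕ → Carrier
  T v i = (v i + v (suc i)) / (v (i +ℕ k) * v (suc (i +ℕ k)))
  S v i = (v (i +ℕ k) + v (suc (i +ℕ k))) / (v i * v (suc i))
  E v j = 1# / v j * (1# / v (j +ℕ k) + 1# / v (j +ℕ k +ℕ 1))

  D : (ℕ → Carrier) → Carrier
  D v = Σ1 (k ∸ 1) (λ l → Σ1 l (λ m →
          ((v l + v (l +ℕ 1)) * (v (k +ℕ m ∸ 1) + v (k +ℕ m)))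
          / (v (k +ℕ l) * v (k +ℕ l +ℕ 1) * v (m ∸ 1) * v m)))

  cong-at : ∀ (v : ℕ → Carrier) {i j} → i ≡ j → v i ≈ v j
  cong-at v i≡j = reflexive (≡.cong v i≡j)

  1+l+1≡2+l : ∀ l → suc l +ℕ 1 ≡ suc (suc l)
  1+l+1≡2+l l = +ℕ-comm (suc l) 1

  k+[1+m]≡1+[m+k] : ∀ m → k +ℕ suc m ≡ suc (m +ℕ k)
  k+[1+m]≡1+[m+k] m = ≡.trans (+-suc k m) (≡.cong suc (+ℕ-comm k m))

  k+[1+m]∸1≡m+k : ∀ m → k +ℕ suc m ∸ 1 ≡ m +ℕ k
  k+[1+m]∸1≡m+k m = ≡.cong (_∸ 1) (k+[1+m]≡1+[m+k] m)

  k+[1+m]+1≡2+[m+k] : ∀ m → k +ℕ suc m +ℕ 1 ≡ suc (suc (m +ℕ k))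
  k+[1+m]+1≡2+[m+k] m = ≡.trans (+ℕ-comm (k +ℕ suc m) 1) (≡.cong suc (k+[1+m]≡1+[m+k] m))

  module _ (v : ℕ → Carrier) (v≉0 : ∀ i → v i ≉ 0#) where

    D-summand : ∀ l m →
      ((v (suc l) + v (suc l +ℕ 1)) * (v (k +ℕ suc m ∸ 1) + v (k +ℕ suc m)))
        / (v (k +ℕ suc l) * v (k +ℕ suc l +ℕ 1) * v m * v (suc m))
      ≈ T v (suc l) * S v m
    D-summand l m = begin
      ((v (suc l) + v (suc l +ℕ 1)) * (v (k +ℕ suc m ∸ 1) + v (k +ℕ suc m)))
        / (v (k +ℕ suc l) * v (k +ℕ suc l +ℕ 1) * v m * v (suc m))
        ≈⟨ *-cong (*-cong (+-congˡ (cong-at v (1+l+1≡2+l l)))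
                          (+-cong (cong-at v (k+[1+m]∸1≡m+k m)) (cong-at v (k+[1+m]≡1+[m+k] m))))
                  (⁻¹-cong (*-congʳ (*-congʳ (*-cong (cong-at v (k+[1+m]≡1+[m+k] l))
                                                     (cong-at v (k+[1+m]+1≡2+[m+k] l)))))) ⟩
      ((v (suc l) + v (suc (suc l))) * (v (m +ℕ k) + v (suc (m +ℕ k))))
        / (v (suc (l +ℕ k)) * v (suc (suc (l +ℕ k))) * v m * v (suc m))
        ≈⟨ /-*-distrib (v≉0 _) (v≉0 _) (v≉0 _) (v≉0 _) ⟩
      T v (suc l) * S v m ∎

    D≈Σtriangle : D v ≈ Σtriangle (k ∸ 1) (T v) (S v)
    D≈Σtriangle = ΣR-cong (k ∸ 1) λ l →
      trans (ΣR-cong (suc l) (D-summand l)) (sym (*-distribˡ-ΣR (suc l) (T v (suc l)) (S v)))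

module Invariance {c ℓ : Level} (F : Field c ℓ) (p : ℕ) where
  open Field F
  open FirstIntegral F
  open FieldProperties F
  open Sums F
  open import Relation.Binary.Reasoning.Setoid setoid

  private
    k n : ℕ
    k = suc p
    n = k +ℕ k

  open Summands F k

  module _ (a : Carrier) (w : ℕ → Carrier) (w≉0 : ∀ i → w i ≉ 0#)
           (recurrence : w 0 * w (suc n) ≈ w 1 * w n + a * (w k + w (suc k))) where
    private
      w′ : ℕ → Carrier
      w′ i = w (suc i)

    D-shift : D w′ + S w 0 * ΣR k (T w′) ≈ D w + T w k * ΣR k (S w)
    D-shift = begin
      D w′ + S w 0 * ΣR k (T w′)                       ≈⟨ +-congʳ (D≈Σtriangle w′ (λ i → w≉0 (suc i))) ⟩
      Σtriangle p (T w′) (S w′) + S w 0 * ΣR k (T w′)  ≈⟨ Σtriangle-shift p (T w) (S w) ⟩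
      Σtriangle p (T w) (S w) + T w k * ΣR k (S w)     ≈⟨ +-congʳ (D≈Σtriangle w w≉0) ⟨
      D w + T w k * ΣR k (S w)                         ∎

    K-shift-invariant : K k a w′ ≈ K k a w
    K-shift-invariant = K-expression-≈
      (ΣR-telescope k (T w)) (ΣR-telescope k (S w)) (ΣR-telescope k (E w)) D-shift
      (ratio-step (w≉0 0) (w≉0 1) recurrence) w₀/wₙ≈
      (ratio-cross (w≉0 n) (w≉0 1) (w≉0 0) (w≉0 (suc n))) residual
      where
      w₀/wₙ≈ : w 0 / w n ≈ w 1 / w (suc n) + a * T w k
      w₀/wₙ≈ = trans (ratio-step (w≉0 (suc n)) (w≉0 n) recurrence′)
                     (+-congˡ (*-congˡ (*-congˡ (⁻¹-cong (*-comm (w (suc n)) (w n))))))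
        where
        recurrence′ : w (suc n) * w 0 ≈ w n * w 1 + a * (w k + w (suc k))
        recurrence′ = trans (*-comm (w (suc n)) (w 0)) (trans recurrence (+-congʳ (*-comm (w 1) (w n))))

      residual : (1# + w 1 / w (suc n)) * S w k + a * (1# / (w (suc k) * w (suc n)) + E w k)
                 ≈ (1# + w n / w 0) * T w 0 + a * (1# / (w k * w n) + E w 0)
      residual = begin
        (1# + w 1 / w (suc n)) * S w k + a * (1# / (w (suc k) * w (suc n)) + E w k)
          ≈⟨ +-congˡ (*-congˡ (+-congˡ (*-congˡ (+-congˡ (1/-at (+ℕ-comm n 1)))))) ⟩
        _ ≈⟨ residual-identity (w≉0 0) (w≉0 k) (w≉0 (suc k)) (w≉0 n) (w≉0 (suc n)) recurrence ⟩
        _ ≈⟨ +-congˡ (*-congˡ (+-congˡ (*-congˡ (+-congˡ (1/-at (+ℕ-comm k 1)))))) ⟨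
        (1# + w n / w 0) * T w 0 + a * (1# / (w k * w n) + E w 0) ∎
        where
        1/-at : ∀ {i j} → i ≡ j → 1# / w i ≈ 1# / w j
        1/-at i≡j = *-congˡ (⁻¹-cong (cong-at w i≡j))

  module _ {f g : ℕ → Carrier} (f≈g : ∀ {i} → i ≤ n → f i ≈ g i) where
    private
      at : ∀ {i j} → i ≡ j → j ≤ n → f i ≈ g i
      at ≡.refl = f≈g
      low : ∀ {j} → j ≤ k → j ≤ n
      low j≤k = ≤-trans j≤k (m≤m+n k k)
      high : ∀ {j} → j ≤ k → j +ℕ k ≤ n
      high = +-monoˡ-≤ k
      1/≈ : ∀ {i} → i ≤ n → 1# / f i ≈ 1# / g i
      1/≈ i≤n = /-cong refl (f≈g i≤n)

    D-local : D f ≈ D g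
    D-local = ΣR-cong-< p λ {l} l<p → ΣR-cong-< (suc l) λ where (s≤s m≤l) → summand≈ l<p m≤l
      where
      summand≈ : ∀ {l m} → l < p → m ≤ l →
        ((f (suc l) + f (suc l +ℕ 1)) * (f (k +ℕ suc m ∸ 1) + f (k +ℕ suc m)))
          / (f (k +ℕ suc l) * f (k +ℕ suc l +ℕ 1) * f m * f (suc m))
        ≈ ((g (suc l) + g (suc l +ℕ 1)) * (g (k +ℕ suc m ∸ 1) + g (k +ℕ suc m)))
          / (g (k +ℕ suc l) * g (k +ℕ suc l +ℕ 1) * g m * g (suc m))
      summand≈ {l} {m} l<p m≤l = /-cong
        (*-cong (+-cong (f≈g (low (<⇒≤ 2+l≤k))) (at (1+l+1≡2+l l) (low 2+l≤k)))
                (+-cong (at (k+[1+m]∸1≡m+k m) (high (<⇒≤ 1+m≤k))) (at (k+[1+m]≡1+[m+k] m) (high 1+m≤k))))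
        (*-cong (*-cong (*-cong (at (k+[1+m]≡1+[m+k] l) (high (<⇒≤ 2+l≤k)))
                                (at (k+[1+m]+1≡2+[m+k] l) (high 2+l≤k)))
                        (f≈g (low (<⇒≤ 1+m≤k))))
                (f≈g (low 1+m≤k)))
        where
        2+l≤k : suc (suc l) ≤ k
        2+l≤k = s≤s l<p
        1+m≤k : suc m ≤ k
        1+m≤k = ≤-trans (s≤s m≤l) (<⇒≤ 2+l≤k)

    K-local : ∀ a → K k a f ≈ K k a g
    K-local a = +-cong (+-cong P0≈ (*-congˡ P1≈)) (*-congˡ P2≈)
      where
      ratio≈ : ∀ {i j} → i ≤ n → j ≤ n → f i / f j ≈ g i / g j
      ratio≈ i≤n j≤n = /-cong (f≈g i≤n) (f≈g j≤n)
      T≈ : ∀ {i} → i < k → T f i ≈ T g i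
      T≈ i<k = /-cong (+-cong (f≈g (low (<⇒≤ i<k))) (f≈g (low i<k)))
                      (*-cong (f≈g (high (<⇒≤ i<k))) (f≈g (high i<k)))
      S≈ : ∀ {i} → i < k → S f i ≈ S g i
      S≈ i<k = /-cong (+-cong (f≈g (high (<⇒≤ i<k))) (f≈g (high i<k)))
                      (*-cong (f≈g (low (<⇒≤ i<k))) (f≈g (low i<k)))
      E≈ : ∀ {j} → j < k → E f j ≈ E g j
      E≈ {j} j<k = *-cong (1/≈ (low (<⇒≤ j<k)))
        (+-cong (1/≈ (high (<⇒≤ j<k))) (/-cong refl (at (+ℕ-comm (j +ℕ k) 1) (high j<k))))
      P0≈ : P0 k a f ≈ P0 k a g
      P0≈ = +-cong (+-congˡ (ratio≈ z≤n ≤-refl)) (ratio≈ ≤-refl z≤n)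
      P1≈ : P1 k a f ≈ P1 k a g
      P1≈ = +-cong (*-cong (+-congˡ (ratio≈ ≤-refl z≤n)) (ΣR-cong-< k T≈))
                   (*-cong (+-congˡ (ratio≈ z≤n ≤-refl)) (ΣR-cong-< k S≈))
      P2≈ : P2 k a f ≈ P2 k a g
      P2≈ = +-cong (+-cong (/-cong refl (*-cong (f≈g (low ≤-refl)) (f≈g ≤-refl))) (ΣR-cong-< k E≈)) D-local

  -- Outside 0 … 2k+1 the value 1 is a junk value that keeps every entry nonzero.
  extend : (ℕ → Carrier) → Carrier → ℕ → Carrier
  extend x y i with i ≤? n
  ... | yes _ = x i
  ... | no  _ with i ≟ suc n
  ...   | yes _ = y
  ...   | no  _ = 1#

  extend-≤ : ∀ x y {i} → i ≤ n → extend x y i ≡ x i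
  extend-≤ x y {i} i≤n with i ≤? n
  ... | yes _   = ≡.refl
  ... | no  i≰n = contradiction i≤n i≰n

  extend-suc : ∀ x y → extend x y (suc n) ≡ y
  extend-suc x y with suc n ≤? n
  ... | yes 1+n≤n = contradiction 1+n≤n 1+n≰n
  ... | no  _ with suc n ≟ suc n
  ...   | yes _   = ≡.refl
  ...   | no  1+n≢1+n = contradiction ≡.refl 1+n≢1+n

  extend-≉0 : ∀ {x y} → (∀ i → i ≤ n → x i ≉ 0#) → y ≉ 0# → ∀ i → extend x y i ≉ 0#
  extend-≉0 {x} x≉0 y≉0 i with i ≤? n
  ... | yes i≤n = x≉0 i i≤n
  ... | no  _ with i ≟ suc n
  ...   | yes _ = y≉0
  ...   | no  _ = 1≉0

  module _ (a : Carrier) (x : ℕ → Carrier) where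
    private
      w : ℕ → Carrier
      w = extend x (next k a x)

    extend-agrees : ∀ {i} → i ≤ n → w i ≈ x i
    extend-agrees i≤n = reflexive (extend-≤ x (next k a x) i≤n)

    φ≈shifted-extension : ∀ {i} → i ≤ n → φ k a x i ≈ w (suc i)
    φ≈shifted-extension {i} i≤n with i ≟ n
    ... | yes ≡.refl = sym (reflexive (extend-suc x (next k a x)))
    ... | no  i≢n    = sym (extend-agrees (≤∧≢⇒< i≤n i≢n))

    extension-recurrence : x 0 ≉ 0# → w 0 * w (suc n) ≈ w 1 * w n + a * (w k + w (suc k))
    extension-recurrence x₀≉0 = begin
      w 0 * w (suc n)
        ≈⟨ *-cong (extend-agrees z≤n) (reflexive (extend-suc x (next k a x))) ⟩
      x 0 * next k a x
        ≈⟨ x*[y/x]≈y _ x₀≉0 ⟩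
      x 1 * x n + a * (x k + x (k +ℕ 1))
        ≈⟨ +-cong (*-cong (extend-agrees (s≤s z≤n)) (extend-agrees ≤-refl))
                  (*-congˡ (+-cong (extend-agrees (m≤m+n k k)) wₖ₊₁≈xₖ₊₁)) ⟨
      w 1 * w n + a * (w k + w (suc k))
        ∎
      where
      wₖ₊₁≈xₖ₊₁ : w (suc k) ≈ x (k +ℕ 1)
      wₖ₊₁≈xₖ₊₁ = trans (extend-agrees (s≤s (m≤n+m k p))) (cong-at x (+ℕ-comm 1 k))

open import Data.Nat.Base using (_+_)

theorem2p9 : ∀ {c ℓ : Level} (F : Field c ℓ) → Field.CharZero F →
    (k : ℕ) → 1 ≤ k → (a : Field.Carrier F) → (x : ℕ → Field.Carrier F) →
    (∀ i → i ≤ k + k → ¬ (Field._≈_ F (x i) (Field.0# F))) →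
    ¬ (Field._≈_ F (FirstIntegral.next F k a x) (Field.0# F)) →
    Field._≈_ F (FirstIntegral.φ*K F k a x) (FirstIntegral.K F k a x)
theorem2p9 F _ (suc p) (s≤s z≤n) a x x≉0 next≉0 = begin
  K k a (φ k a x)          ≈⟨ K-local (φ≈shifted-extension a x) a ⟩
  K k a (λ i → w (suc i))  ≈⟨ K-shift-invariant a w (extend-≉0 x≉0 next≉0)
                                                  (extension-recurrence a x (x≉0 0 z≤n)) ⟩
  K k a w                  ≈⟨ K-local (extend-agrees a x) a ⟩
  K k a x                  ∎
  where
  open Field F
  open FirstIntegral F
  open Invariance F p
  open import Relation.Binary.Reasoning.Setoid setoid
  k : ℕ
  k = suc p
  w : ℕ → Carrier
  w = extend x (next k a x)
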